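{- Let $k\geq 2$ and $p\geq 0$ be integers and let $n=2(p+1)k+2$. Let \[ G=K_{1}\vee\big((pK_{2k})\cup K_{2k+1}\big), \] i.e., the graph obtained by taking the disjoint union of $p$ copies of $K_{2k}$ and one copy of $K_{2k+1}$ and adding a new vertex adjacent to all their vertices. If $n\geq 6k+13$, then $q(G)<n+2k-2$.
   Context: All graphs are finite and simple. $K_m$ is the complete graph on $m$ vertices; $\vee$ denotes the join of graphs. For a graph $G$, the signless Laplacian is $Q(G)=D(G)+A(G)$, where $D(G)$ is the diagonal matrix of vertex degrees and $A(G)$ the adjacency matrix; $q(G)$ denotes the largest eigenvalue of $Q(G)$. -}

module Defs where

open import Level using (Level; _⊔_) renaming (suc to lsuc)
open import Data.Bool using (Bool; true; false; if_then_else_; _∧_; _∨_; not)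
open import Data.Bool.Properties using (∨-comm; ∧-comm)
open import Data.Nat using (ℕ; zero; suc; _∸_; _<ᵇ_; _≡ᵇ_)

open import Data.Nat using () renaming (_+_ to _+ℕ_; _*_ to _*ℕ_)
open import Data.Fin using (Fin; toℕ)
import Data.Fin as Fin
open import Data.Product using (Σ; ∃; _×_; _,_)
open import Relation.Nullary using (¬_; yes; no)
open import Relation.Nullary.Decidable using (⌊_⌋)
open import Relation.Binary using (Rel; IsStrictTotalOrder)
open import Relation.Binary.PropositionalEquality using (_≡_; refl; sym; cong)
open import Algebra.Bundles using (CommutativeRing)

record OrderedField (c ℓ₁ ℓ₂ : Level) : Set (lsuc (c ⊔ ℓ₁ ⊔ ℓ₂)) where
  field
    commutativeRing : CommutativeRing c ℓ₁
  open CommutativeRing commutativeRing public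
  field
    _<_                  : Rel Carrier ℓ₂
    <-isStrictTotalOrder : IsStrictTotalOrder _≈_ _<_
    1≉0                  : ¬ (1# ≈ 0#)
    inverse              : ∀ x → ¬ (x ≈ 0#) → ∃ λ y → x * y ≈ 1#
    +-monoˡ-<            : ∀ {x y} z → x < y → (x + z) < (y + z)
    *-pos                : ∀ {x y} → 0# < x → 0# < y → 0# < (x * y)

  fromℕ : ℕ → Carrier
  fromℕ zero    = 0#
  fromℕ (suc m) = 1# + fromℕ m

  Σ[_] : ∀ {n} → (Fin n → Carrier) → Carrier
  Σ[_] {zero}  f = 0#
  Σ[_] {suc n} f = f Fin.zero + Σ[ (λ i → f (Fin.suc i)) ]

  IsEigenvalue : ∀ {n} → (Fin n → Fin n → Carrier) → Carrier → Set (c ⊔ ℓ₁)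
  IsEigenvalue {n} M λ′ =
    Σ (Fin n → Carrier) λ x →
      (∃ λ i → ¬ (x i ≈ 0#)) ×
      (∀ i → Σ[ (λ j → M i j * x j) ] ≈ λ′ * x i)

record SimpleGraph (n : ℕ) : Set where
  field
    adj       : Fin n → Fin n → Bool
    adj-sym   : ∀ u v → adj u v ≡ adj v u
    adj-irrefl : ∀ v → adj v v ≡ false

open SimpleGraph public

b2n : Bool → ℕ
b2n true  = 1
b2n false = 0

sumℕ : ∀ {n} → (Fin n → ℕ) → ℕ
sumℕ {zero}  f = 0
sumℕ {suc n} f = f Fin.zero +ℕ sumℕ (λ i → f (Fin.suc i))

degree : ∀ {n} → SimpleGraph n → Fin n → ℕ
degree G v = sumℕ (λ u → b2n (adj G v u))

signlessLaplacian : ∀ {n} → SimpleGraph n → Fin n → Fin n → ℕ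
signlessLaplacian G u v = degree G u *ℕ b2n ⌊ u Fin.≟ v ⌋ +ℕ b2n (adj G u v)

-- The graph K₁ ∨ ((p K_{2k}) ∪ K_{2k+1})
-- Vertex 0 is the K₁; vertices 1 .. n-1 (with m = vertex - 1) are split
-- into consecutive blocks: p blocks of size 2k, then the final block
-- (of size 2k+1).

order : ℕ → ℕ → ℕ
order k p = 2 *ℕ (p +ℕ 1) *ℕ k +ℕ 2

block : (s p m : ℕ) → ℕ
block s zero    m = 0
block s (suc p) m = if m <ᵇ s then 0 else suc (block s p (m ∸ s))

private
  rel : ℕ → ℕ → ℕ → ℕ → Bool
  rel k p a b = (a ≡ᵇ 0) ∨ ((b ≡ᵇ 0) ∨ (block (2 *ℕ k) p (a ∸ 1) ≡ᵇ block (2 *ℕ k) p (b ∸ 1)))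

  ≡ᵇ-sym : ∀ a b → (a ≡ᵇ b) ≡ (b ≡ᵇ a)
  ≡ᵇ-sym zero zero = refl
  ≡ᵇ-sym zero (suc b) = refl
  ≡ᵇ-sym (suc a) zero = refl
  ≡ᵇ-sym (suc a) (suc b) = ≡ᵇ-sym a b

  ∨-swap : ∀ x y z → x ∨ (y ∨ z) ≡ y ∨ (x ∨ z)
  ∨-swap true  y z = sym (∨-comm y true)
  ∨-swap false y z = refl

  rel-sym : ∀ k p a b → rel k p a b ≡ rel k p b a
  rel-sym k p a b
    rewrite ≡ᵇ-sym (block (2 *ℕ k) p (a ∸ 1)) (block (2 *ℕ k) p (b ∸ 1))
    = ∨-swap (a ≡ᵇ 0) (b ≡ᵇ 0) _

  neq : ∀ {n} → Fin n → Fin n → Bool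
  neq u v = not ⌊ u Fin.≟ v ⌋

  neq-sym : ∀ {n} (u v : Fin n) → neq u v ≡ neq v u
  neq-sym u v with u Fin.≟ v | v Fin.≟ u
  ... | yes _ | yes _ = refl
  ... | no _  | no _  = refl
  ... | yes e | no ne = Data.Empty.⊥-elim (ne (sym e))
    where import Data.Empty
  ... | no ne | yes e = Data.Empty.⊥-elim (ne (sym e))
    where import Data.Empty

  neq-refl : ∀ {n} (v : Fin n) → neq v v ≡ false
  neq-refl v with v Fin.≟ v
  ... | yes _ = refl
  ... | no ne = Data.Empty.⊥-elim (ne refl)
    where import Data.Empty

joinGraph : (k p : ℕ) → SimpleGraph (order k p)
joinGraph k p = record
  { adj        = λ u v → neq u v ∧ rel k p (toℕ u) (toℕ v)
  ; adj-sym    = λ u v → Relation.Binary.PropositionalEquality.cong₂ _∧_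
                           (neq-sym u v) (rel-sym k p (toℕ u) (toℕ v))
  ; adj-irrefl = λ v → Relation.Binary.PropositionalEquality.cong
                           (_∧ rel k p (toℕ v) (toℕ v)) (neq-refl v)
  }
  where import Relation.Binary.PropositionalEquality

-- Weight the apex (vertex 0) by 1 and every other vertex by α, and look at a
-- vertex i where the weighted eigenvector entry is largest; after a change of
-- sign it is positive. Row i of Q x = μ x, multiplied by α, then bounds α μ by a
-- weighted row sum of Q: (α + 1)(n − 1) at the apex, and
-- α(2k + 2) + α² + (2k + 2)α elsewhere, because every other vertex sees the apex
-- once and at most 2k + 1 vertices of its own clique. For α = n − 2k − 7 both
-- are below α(n + 2k − 2) as soon as n ≥ 6k + 13.
module Submission where

open import Defs
open import Level using (Level)

module DegreeBounds where

  open import Data.Bool using (Bool; true; false; T; _∧_; _∨_)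
  open import Data.Empty using (⊥-elim)
  open import Data.Fin as Fin using (Fin; toℕ)
  open import Data.Nat
  open import Data.Nat.Properties
  open import Data.Nat.Tactic.RingSolver using (solve-∀)
  open import Data.Unit using (tt)
  open import Function using (_∘_)
  open import Relation.Nullary using (contradiction)
  open import Relation.Binary.PropositionalEquality
  open ≤-Reasoning

  b2n≤1 : ∀ b → b2n b ≤ 1
  b2n≤1 true  = ≤-refl
  b2n≤1 false = z≤n

  b2n-∧-≤ʳ : ∀ x y → b2n (x ∧ y) ≤ b2n y
  b2n-∧-≤ʳ true  y = ≤-refl
  b2n-∧-≤ʳ false y = z≤n

  sumℕ-mono : ∀ {n} {f g : Fin n → ℕ} → (∀ u → f u ≤ g u) → sumℕ f ≤ sumℕ g
  sumℕ-mono {zero}  f≤g = z≤n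
  sumℕ-mono {suc n} f≤g = +-mono-≤ (f≤g Fin.zero) (sumℕ-mono (f≤g ∘ Fin.suc))

  sumℕ-b2n-≤ : ∀ {n} (P : Fin n → Bool) → sumℕ (b2n ∘ P) ≤ n
  sumℕ-b2n-≤ {zero}  P = z≤n
  sumℕ-b2n-≤ {suc n} P = +-mono-≤ (b2n≤1 (P Fin.zero)) (sumℕ-b2n-≤ (P ∘ Fin.suc))

  sumℕ-b2n-≤-pred : ∀ {n} (P : Fin n → Bool) v → P v ≡ false → sumℕ (b2n ∘ P) ≤ n ∸ 1
  sumℕ-b2n-≤-pred P Fin.zero Pv≡false rewrite Pv≡false = sumℕ-b2n-≤ (P ∘ Fin.suc)
  sumℕ-b2n-≤-pred {suc (suc n)} P (Fin.suc v) Pv≡false =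
    +-mono-≤ (b2n≤1 (P Fin.zero)) (sumℕ-b2n-≤-pred (P ∘ Fin.suc) v Pv≡false)

  degree-≤-pred : ∀ {n} (G : SimpleGraph n) v → degree G v ≤ n ∸ 1
  degree-≤-pred G v = sumℕ-b2n-≤-pred (adj G v) v (adj-irrefl G v)

  sumTo : ℕ → (ℕ → ℕ) → ℕ
  sumTo zero    f = 0
  sumTo (suc L) f = f 0 + sumTo L (f ∘ suc)

  sumℕ-toℕ : ∀ n (f : ℕ → ℕ) → sumℕ {n} (f ∘ toℕ) ≡ sumTo n f
  sumℕ-toℕ zero    f = refl
  sumℕ-toℕ (suc n) f = cong (f 0 +_) (sumℕ-toℕ n (f ∘ suc))

  sumTo-+ : ∀ s L f → sumTo (s + L) f ≡ sumTo s f + sumTo L (f ∘ (s +_))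
  sumTo-+ zero    L f = refl
  sumTo-+ (suc s) L f = trans (cong (f 0 +_) (sumTo-+ s L (f ∘ suc))) (sym (+-assoc (f 0) _ _))

  sumTo-cong : ∀ L {f g} → (∀ m → m < L → f m ≡ g m) → sumTo L f ≡ sumTo L g
  sumTo-cong zero    f≡g = refl
  sumTo-cong (suc L) f≡g = cong₂ _+_ (f≡g 0 z<s) (sumTo-cong L (λ m m<L → f≡g (suc m) (s<s m<L)))

  sumTo-zero : ∀ L → sumTo L (λ _ → 0) ≡ 0
  sumTo-zero zero    = refl
  sumTo-zero (suc L) = sumTo-zero L

  sumTo-b2n-≤ : ∀ L (P : ℕ → Bool) → sumTo L (b2n ∘ P) ≤ L
  sumTo-b2n-≤ zero    P = z≤n
  sumTo-b2n-≤ (suc L) P = +-mono-≤ (b2n≤1 (P 0)) (sumTo-b2n-≤ L (P ∘ suc))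

  block-initial : ∀ s p m → m < s → block s (suc p) m ≡ 0
  block-initial s p m m<s with m <ᵇ s in m<ᵇs
  ... | true  = refl
  ... | false = contradiction (<⇒<ᵇ m<s) (subst T m<ᵇs)

  block-shift : ∀ s p m → block s (suc p) (s + m) ≡ suc (block s p m)
  block-shift s p m with (s + m) <ᵇ s in s+m<ᵇs
  ... | true  = ⊥-elim (m+n≮m s m (<ᵇ⇒< (s + m) s (subst T (sym s+m<ᵇs) tt)))
  ... | false = cong (suc ∘ block s p) (m+n∸m≡n s m)

  -- The indices below s·p + s + 1 form p blocks of length s and a last one of length s + 1.
  block-fibre-≤ : ∀ s p b → sumTo (s * p + suc s) (λ m → b2n (b ≡ᵇ block s p m)) ≤ suc s
  block-fibre-≤ s zero b =
    subst (λ L → sumTo (L + suc s) (λ m → b2n (b ≡ᵇ block s zero m)) ≤ suc s)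
      (sym (*-zeroʳ s)) (sumTo-b2n-≤ (suc s) (λ _ → b ≡ᵇ 0))
  block-fibre-≤ s (suc p) b = begin
    sumTo (s * suc p + suc s) f                                      ≡⟨ cong (λ L → sumTo L f) length≡ ⟩
    sumTo (s + L) f                                                  ≡⟨ sumTo-+ s L f ⟩
    sumTo s f + sumTo L (f ∘ (s +_))                                  ≡⟨ cong₂ _+_ initial shifted ⟩
    sumTo s (λ _ → b2n (b ≡ᵇ 0)) + sumTo L (λ m → b2n (b ≡ᵇ suc (block s p m))) ≤⟨ halves b ⟩
    suc s                                                            ∎
    where
    L = s * p + suc s
    f = λ m → b2n (b ≡ᵇ block s (suc p) m)

    length≡ : s * suc p + suc s ≡ s + L
    length≡ = trans (cong (_+ suc s) (*-suc s p)) (+-assoc s (s * p) (suc s))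

    initial : sumTo s f ≡ sumTo s (λ _ → b2n (b ≡ᵇ 0))
    initial = sumTo-cong s (λ m m<s → cong (λ c → b2n (b ≡ᵇ c)) (block-initial s p m m<s))

    shifted : sumTo L (f ∘ (s +_)) ≡ sumTo L (λ m → b2n (b ≡ᵇ suc (block s p m)))
    shifted = sumTo-cong L (λ m _ → cong (λ c → b2n (b ≡ᵇ c)) (block-shift s p m))

    halves : ∀ b → sumTo s (λ _ → b2n (b ≡ᵇ 0)) + sumTo L (λ m → b2n (b ≡ᵇ suc (block s p m))) ≤ suc s
    halves zero     = begin
      sumTo s (λ _ → 1) + sumTo L (λ _ → 0) ≡⟨ cong (_ +_) (sumTo-zero L) ⟩
      sumTo s (λ _ → 1) + 0                 ≡⟨ +-identityʳ _ ⟩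
      sumTo s (λ _ → 1)                     ≤⟨ sumTo-b2n-≤ s (λ _ → true) ⟩
      s                                     <⟨ n<1+n s ⟩
      suc s                                 ∎
    halves (suc b′) = subst (λ z → z + sumTo L (λ m → b2n (b′ ≡ᵇ block s p m)) ≤ suc s)
                        (sym (sumTo-zero s)) (block-fibre-≤ s p b′)

  order≡ : ∀ k p → order k p ≡ suc (2 * k * p + suc (2 * k))
  order≡ = polynomial-identity
    where
    polynomial-identity : ∀ k p → 2 * (p + 1) * k + 2 ≡ suc (2 * k * p + suc (2 * k))
    polynomial-identity = solve-∀

  apexOrInBlock : ℕ → ℕ → ℕ → ℕ → Bool
  apexOrInBlock k p b a = (a ≡ᵇ 0) ∨ (b ≡ᵇ block (2 * k) p (a ∸ 1))

  joinGraph-adj-≤ : ∀ k p (v : Fin (order k p)) m → toℕ v ≡ suc m → ∀ u →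
    b2n (adj (joinGraph k p) v u) ≤ b2n (apexOrInBlock k p (block (2 * k) p m) (toℕ u))
  joinGraph-adj-≤ k p v m v≡ u rewrite v≡ = b2n-∧-≤ʳ _ _

  joinGraph-degree-≤ : ∀ k p (v : Fin (order k p)) m → toℕ v ≡ suc m → degree (joinGraph k p) v ≤ 2 * k + 2
  joinGraph-degree-≤ k p v m v≡ = begin
    degree (joinGraph k p) v                 ≤⟨ sumℕ-mono (joinGraph-adj-≤ k p v m v≡) ⟩
    sumℕ {order k p} (neighbour ∘ toℕ)       ≡⟨ sumℕ-toℕ (order k p) neighbour ⟩
    sumTo (order k p) neighbour              ≡⟨ cong (λ L → sumTo L neighbour) (order≡ k p) ⟩
    suc (sumTo (2 * k * p + suc (2 * k)) (λ a → b2n (b ≡ᵇ block (2 * k) p a)))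
                                             ≤⟨ s≤s (block-fibre-≤ (2 * k) p b) ⟩
    2 + 2 * k                                ≡⟨ +-comm 2 (2 * k) ⟩
    2 * k + 2                                ∎
    where
    b = block (2 * k) p m
    neighbour = b2n ∘ apexOrInBlock k p b

module ApexWeight where

  open import Data.Nat
  open import Data.Nat.Properties using (m≤n⇒∃[o]m+o≡n; m<m+n)
  open import Data.Nat.Tactic.RingSolver using (solve-∀)
  open import Data.Product using (∃; _×_; _,_)
  open import Relation.Binary.PropositionalEquality using (_≡_; refl; sym; cong; subst; subst₂)

  <-by-excess : ∀ x d {y} → x + suc d ≡ y → x < y
  <-by-excess x d x+1+d≡y = subst (x <_) x+1+d≡y (m<m+n x z<s)

  -- α = n − 2k − 7: the row condition at the apex amounts to n − 1 < α(2k − 1),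
  -- the one at the other vertices to α < n − 2k − 6.
  apex-weight : ∀ n k → 2 ≤ k → 6 * k + 13 ≤ n →
    ∃ λ α → 1 ≤ α
          × (α + 1) * (n ∸ 1) < α * (n + 2 * k ∸ 2)
          × α * (2 * k + 2) + α * α + (2 * k + 2) * α < α * (n + 2 * k ∸ 2)
  apex-weight n k 2≤k 6k+13≤n with m≤n⇒∃[o]m+o≡n 2≤k | m≤n⇒∃[o]m+o≡n 6k+13≤n
  ... | a , refl | e , refl = α , s≤s z≤n , apex-row-< , other-row-<
    where
    k′ = 2 + a
    n′ = 6 * k′ + 13 + e
    α  = 4 * k′ + 6 + e

    n′∸1≡ : n′ ∸ 1 ≡ 6 * k′ + 12 + e
    n′∸1≡ = cong (_∸ 1) (identity k′ e)
      where
      identity : ∀ k e → 6 * k + 13 + e ≡ 1 + (6 * k + 12 + e)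
      identity = solve-∀

    N≡ : n′ + 2 * k′ ∸ 2 ≡ 8 * k′ + 11 + e
    N≡ = cong (_∸ 2) (identity k′ e)
      where
      identity : ∀ k e → 6 * k + 13 + e + 2 * k ≡ 2 + (8 * k + 11 + e)
      identity = solve-∀

    apex-row-< : (α + 1) * (n′ ∸ 1) < α * (n′ + 2 * k′ ∸ 2)
    apex-row-< = subst₂ (λ n-1 N → (α + 1) * n-1 < α * N) (sym n′∸1≡) (sym N≡)
      (<-by-excess _ (17 + 34 * a + 8 * (a * a) + 2 * e + 2 * (a * e)) (identity a e))
      where
      identity : ∀ a e →
        (4 * (2 + a) + 6 + e + 1) * (6 * (2 + a) + 12 + e) + suc (17 + 34 * a + 8 * (a * a) + 2 * e + 2 * (a * e))
          ≡ (4 * (2 + a) + 6 + e) * (8 * (2 + a) + 11 + e)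
      identity = solve-∀

    other-row-< : α * (2 * k′ + 2) + α * α + (2 * k′ + 2) * α < α * (n′ + 2 * k′ ∸ 2)
    other-row-< = subst (λ N → α * (2 * k′ + 2) + α * α + (2 * k′ + 2) * α < α * N) (sym N≡)
      (<-by-excess _ (4 * k′ + 5 + e) (identity k′ e))
      where
      identity : ∀ k e →
        (4 * k + 6 + e) * (2 * k + 2) + (4 * k + 6 + e) * (4 * k + 6 + e) + (2 * k + 2) * (4 * k + 6 + e) + suc (4 * k + 5 + e)
          ≡ (4 * k + 6 + e) * (8 * k + 11 + e)
      identity = solve-∀

module EigenvalueBound {c ℓ₁ ℓ₂} (F : OrderedField c ℓ₁ ℓ₂) where

  open import Data.Empty using (⊥; ⊥-elim)
  open import Data.Fin as Fin using (Fin; toℕ)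
  open import Data.Nat as ℕ using (ℕ; zero; suc; z≤n; s≤s)
  import Data.Nat.Properties as ℕ
  open import Data.Product using (Σ; ∃; _×_; _,_)
  open import Data.Sum using (_⊎_; inj₁; inj₂)
  open import Function using (_∘_)
  open import Relation.Binary using (StrictPartialOrder; IsStrictTotalOrder; tri<; tri≈; tri>)
  open import Relation.Nullary.Decidable using (⌊_⌋; ⌊⌋-map′)
  import Relation.Binary.PropositionalEquality as ≡
  open ≡ using (_≡_)

  open OrderedField F hiding (_<_)
  open IsStrictTotalOrder <-isStrictTotalOrder
    using (compare; isStrictPartialOrder; <-respʳ-≈)
    renaming (irrefl to <-irrefl; trans to <-trans)
  open import Algebra.Properties.Ring ring using (-1*x≈-x; -‿involutive; -‿distribʳ-*)
  open import Algebra.Properties.Semiring.Sum semiring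
    using (sum; sum-cong-≋; sum-replicate-zero; ∑-distrib-+; *-distribˡ-sum)
  open import Algebra.Properties.Semiring.Mult semiring using (×-homo-+; ×1-homo-*) renaming (_×_ to _×′_)
  open import Algebra.Solver.Ring.NaturalCoefficients.Default commutativeSemiring
    using (solve; _:=_; _:+_; _:*_; con)
  open DegreeBounds using (b2n≤1)

  strictPartialOrder : StrictPartialOrder c ℓ₁ ℓ₂
  strictPartialOrder = record { isStrictPartialOrder = isStrictPartialOrder }

  -- The field _<_ of OrderedField has no fixity; the bundle's copy is infix 4.
  open StrictPartialOrder strictPartialOrder using (_<_)
  open import Relation.Binary.Construct.StrictToNonStrict _≈_ _<_ using (_≤_; <⇒≤)
  open import Relation.Binary.Reasoning.StrictPartialOrder strictPartialOrder

  <-or-≥ : ∀ x y → x < y ⊎ y ≤ x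
  <-or-≥ x y with compare x y
  ... | tri< x<y _ _ = inj₁ x<y
  ... | tri≈ _ x≈y _ = inj₂ (inj₂ (sym x≈y))
  ... | tri> _ _ y<x = inj₂ (inj₁ y<x)

  x<y⇒0<y-x : ∀ {x y} → x < y → 0# < y - x
  x<y⇒0<y-x {x} {y} x<y = begin-strict
    0#      ≈⟨ sym (-‿inverseʳ x) ⟩
    x - x   <⟨ +-monoˡ-< (- x) x<y ⟩
    y - x   ∎

  0<y-x⇒x<y : ∀ {x y} → 0# < y - x → x < y
  0<y-x⇒x<y {x} {y} 0<y-x = begin-strict
    x            ≈⟨ sym (+-identityˡ x) ⟩
    0# + x       <⟨ +-monoˡ-< x 0<y-x ⟩
    y - x + x    ≈⟨ +-assoc y (- x) x ⟩
    y + (- x + x) ≈⟨ +-congˡ (-‿inverseˡ x) ⟩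
    y + 0#       ≈⟨ +-identityʳ y ⟩
    y            ∎

  neg-pos : ∀ {x} → x < 0# → 0# < - x
  neg-pos {x} x<0 = <-respʳ-≈ (+-identityˡ (- x)) (x<y⇒0<y-x x<0)

  -- If 1 < 0 then 0 < -1, and the square of -1 would be a positive 1.
  0<1 : 0# < 1#
  0<1 with compare 0# 1#
  ... | tri< 0<1″ _ _ = 0<1″
  ... | tri≈ _ 0≈1 _ = ⊥-elim (1≉0 (sym 0≈1))
  ... | tri> _ _ 1<0 = ⊥-elim (<-irrefl refl (<-trans 0<1′ 1<0))
    where
    0<-1 : 0# < - 1#
    0<-1 = neg-pos 1<0
    0<1′ : 0# < 1#
    0<1′ = <-respʳ-≈ (trans (-1*x≈-x (- 1#)) (-‿involutive 1#)) (*-pos 0<-1 0<-1)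

  +-monoʳ-< : ∀ {x y} z → x < y → z + x < z + y
  +-monoʳ-< {x} {y} z x<y = begin-strict
    z + x  ≈⟨ +-comm z x ⟩
    x + z  <⟨ +-monoˡ-< z x<y ⟩
    y + z  ≈⟨ +-comm y z ⟩
    z + y  ∎

  +-mono-≤ : ∀ {x y u v} → x ≤ y → u ≤ v → x + u ≤ y + v
  +-mono-≤ {x} {y} {u} {v} x≤y u≤v = begin
    x + u  ≤⟨ monoˡ u x≤y ⟩
    y + u  ≤⟨ monoʳ y u≤v ⟩
    y + v  ∎
    where
    monoˡ : ∀ {x y} z → x ≤ y → x + z ≤ y + z
    monoˡ z (inj₁ x<y) = inj₁ (+-monoˡ-< z x<y)
    monoˡ z (inj₂ x≈y) = inj₂ (+-congʳ x≈y)
    monoʳ : ∀ {x y} z → x ≤ y → z + x ≤ z + y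
    monoʳ z (inj₁ x<y) = inj₁ (+-monoʳ-< z x<y)
    monoʳ z (inj₂ x≈y) = inj₂ (+-congˡ x≈y)

  *-monoˡ-< : ∀ {x y z} → 0# < z → x < y → z * x < z * y
  *-monoˡ-< {x} {y} {z} 0<z x<y = 0<y-x⇒x<y (begin-strict
    0#              <⟨ *-pos 0<z (x<y⇒0<y-x x<y) ⟩
    z * (y - x)     ≈⟨ distribˡ z y (- x) ⟩
    z * y + z * - x ≈⟨ +-congˡ (sym (-‿distribʳ-* z x)) ⟩
    z * y - z * x   ∎)

  *-monoʳ-< : ∀ {x y z} → 0# < z → x < y → x * z < y * z
  *-monoʳ-< {x} {y} {z} 0<z x<y = begin-strict
    x * z  ≈⟨ *-comm x z ⟩
    z * x  <⟨ *-monoˡ-< 0<z x<y ⟩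
    z * y  ≈⟨ *-comm z y ⟩
    y * z  ∎

  *-monoˡ-≤ : ∀ {x y z} → 0# ≤ z → x ≤ y → z * x ≤ z * y
  *-monoˡ-≤ (inj₁ 0<z) (inj₁ x<y) = inj₁ (*-monoˡ-< 0<z x<y)
  *-monoˡ-≤ (inj₁ 0<z) (inj₂ x≈y) = inj₂ (*-congˡ x≈y)
  *-monoˡ-≤ {x} {y} (inj₂ 0≈z) _  = inj₂ (begin-equality
    _ * x  ≈⟨ *-congʳ (sym 0≈z) ⟩
    0# * x ≈⟨ zeroˡ x ⟩
    0#     ≈⟨ sym (zeroˡ y) ⟩
    0# * y ≈⟨ *-congʳ 0≈z ⟩
    _ * y  ∎)

  *-monoʳ-≤ : ∀ {x y z} → 0# ≤ z → x ≤ y → x * z ≤ y * z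
  *-monoʳ-≤ {x} {y} {z} 0≤z x≤y = begin
    x * z  ≈⟨ *-comm x z ⟩
    z * x  ≤⟨ *-monoˡ-≤ 0≤z x≤y ⟩
    z * y  ≈⟨ *-comm z y ⟩
    y * z  ∎

  pos-*-cancelˡ : ∀ {y z} → 0# < z → 0# < z * y → 0# < y
  pos-*-cancelˡ {y} {z} 0<z 0<zy with compare y 0#
  ... | tri> _ _ 0<y = 0<y
  ... | tri≈ _ y≈0 _ = ⊥-elim (<-irrefl (sym (trans (*-congˡ y≈0) (zeroʳ z))) 0<zy)
  ... | tri< y<0 _ _ = ⊥-elim (<-irrefl refl (begin-strict
    0#     <⟨ 0<zy ⟩
    z * y  <⟨ *-monoˡ-< 0<z y<0 ⟩
    z * 0# ≈⟨ zeroʳ z ⟩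
    0#     ∎))

  fromℕ≡×1 : ∀ m → fromℕ m ≡ m ×′ 1#
  fromℕ≡×1 zero    = ≡.refl
  fromℕ≡×1 (suc m) = ≡.cong (1# +_) (fromℕ≡×1 m)

  fromℕ-+ : ∀ m n → fromℕ (m ℕ.+ n) ≈ fromℕ m + fromℕ n
  fromℕ-+ m n rewrite fromℕ≡×1 (m ℕ.+ n) | fromℕ≡×1 m | fromℕ≡×1 n = ×-homo-+ 1# m n

  fromℕ-* : ∀ m n → fromℕ (m ℕ.* n) ≈ fromℕ m * fromℕ n
  fromℕ-* m n rewrite fromℕ≡×1 (m ℕ.* n) | fromℕ≡×1 m | fromℕ≡×1 n = ×1-homo-* m n

  fromℕ-nonneg : ∀ m → 0# ≤ fromℕ m
  fromℕ-nonneg zero    = inj₂ refl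
  fromℕ-nonneg (suc m) = inj₁ (begin-strict
    0#            ≈⟨ sym (+-identityʳ 0#) ⟩
    0# + 0#       <⟨ +-monoˡ-< 0# 0<1 ⟩
    1# + 0#       ≤⟨ +-mono-≤ (inj₂ refl) (fromℕ-nonneg m) ⟩
    1# + fromℕ m  ∎)

  fromℕ-mono-≤ : ∀ {m n} → m ℕ.≤ n → fromℕ m ≤ fromℕ n
  fromℕ-mono-≤ {n = n} z≤n = fromℕ-nonneg n
  fromℕ-mono-≤ (s≤s m≤n)   = +-mono-≤ (inj₂ refl) (fromℕ-mono-≤ m≤n)

  fromℕ-mono-< : ∀ {m n} → m ℕ.< n → fromℕ m < fromℕ n
  fromℕ-mono-< {m} {suc n} (s≤s m≤n) = begin-strict
    fromℕ m       ≈⟨ sym (+-identityˡ _) ⟩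
    0# + fromℕ m  <⟨ +-monoˡ-< (fromℕ m) 0<1 ⟩
    1# + fromℕ m  ≤⟨ +-mono-≤ (inj₂ refl) (fromℕ-mono-≤ m≤n) ⟩
    1# + fromℕ n  ∎

  fromℕ-*-≤ : ∀ {m c y B} → m ℕ.≤ c → y ≤ B → 0# ≤ B → fromℕ m * y ≤ fromℕ c * B
  fromℕ-*-≤ {m} {c} {y} {B} m≤c y≤B 0≤B = begin
    fromℕ m * y  ≤⟨ *-monoˡ-≤ (fromℕ-nonneg m) y≤B ⟩
    fromℕ m * B  ≤⟨ *-monoʳ-≤ 0≤B (fromℕ-mono-≤ m≤c) ⟩
    fromℕ c * B  ∎

  Σ≡sum : ∀ {n} (f : Fin n → Carrier) → Σ[ f ] ≡ sum f
  Σ≡sum {zero}  f = ≡.refl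
  Σ≡sum {suc n} f = ≡.cong (f Fin.zero +_) (Σ≡sum (f ∘ Fin.suc))

  sum-neg : ∀ {n} (f : Fin n → Carrier) → sum (λ j → - f j) ≈ - sum f
  sum-neg f = begin-equality
    sum (λ j → - f j)       ≈⟨ sum-cong-≋ (λ j → sym (-1*x≈-x (f j))) ⟩
    sum (λ j → - 1# * f j)  ≈⟨ sym (*-distribˡ-sum (- 1#) f) ⟩
    - 1# * sum f            ≈⟨ -1*x≈-x (sum f) ⟩
    - sum f                 ∎

  off-diagonal : ∀ d y → fromℕ (d ℕ.* 0) * y ≈ 0#
  off-diagonal d y rewrite ℕ.*-zeroʳ d = zeroˡ y

  sum-diagonal : ∀ {n} (i : Fin n) d (z : Fin n → Carrier) →
    sum (λ j → fromℕ (d ℕ.* b2n ⌊ i Fin.≟ j ⌋) * z j) ≈ fromℕ d * z i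
  sum-diagonal {suc n} Fin.zero d z = begin-equality
    fromℕ (d ℕ.* 1) * z Fin.zero + sum (λ j → fromℕ (d ℕ.* 0) * z (Fin.suc j))
      ≈⟨ +-cong (*-congʳ (reflexive (≡.cong fromℕ (ℕ.*-identityʳ d))))
                (trans (sum-cong-≋ (λ j → off-diagonal d (z (Fin.suc j)))) (sum-replicate-zero n)) ⟩
    fromℕ d * z Fin.zero + 0#  ≈⟨ +-identityʳ _ ⟩
    fromℕ d * z Fin.zero       ∎
  sum-diagonal {suc (suc n)} (Fin.suc i) d z = begin-equality
    fromℕ (d ℕ.* 0) * z Fin.zero + sum (λ j → fromℕ (d ℕ.* b2n ⌊ Fin.suc i Fin.≟ Fin.suc j ⌋) * z (Fin.suc j))
      ≈⟨ +-cong (off-diagonal d (z Fin.zero)) (trans (sum-cong-≋ shift) (sum-diagonal i d (z ∘ Fin.suc))) ⟩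
    0# + fromℕ d * z (Fin.suc i)  ≈⟨ +-identityˡ _ ⟩
    fromℕ d * z (Fin.suc i)       ∎
    where
    shift : ∀ j → fromℕ (d ℕ.* b2n ⌊ Fin.suc i Fin.≟ Fin.suc j ⌋) * z (Fin.suc j)
                ≈ fromℕ (d ℕ.* b2n ⌊ i Fin.≟ j ⌋) * z (Fin.suc j)
    shift j = *-congʳ (reflexive (≡.cong (λ b → fromℕ (d ℕ.* b2n b)) (⌊⌋-map′ _ _ (i Fin.≟ j))))


  sum-fromℕ-*-≤ : ∀ {n} (f : Fin n → ℕ) {z : Fin n → Carrier} {B c} →
    (∀ j → z j ≤ B) → 0# ≤ B → sumℕ f ℕ.≤ c → sum (λ j → fromℕ (f j) * z j) ≤ fromℕ c * B
  sum-fromℕ-*-≤ f {z} {B} {c} z≤B 0≤B Σf≤c = begin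
    sum (λ j → fromℕ (f j) * z j)  ≤⟨ sum-≤ f z≤B ⟩
    fromℕ (sumℕ f) * B              ≤⟨ *-monoʳ-≤ 0≤B (fromℕ-mono-≤ Σf≤c) ⟩
    fromℕ c * B                     ∎
    where
    sum-≤ : ∀ {n} (f : Fin n → ℕ) {z : Fin n → Carrier} → (∀ j → z j ≤ B) →
      sum (λ j → fromℕ (f j) * z j) ≤ fromℕ (sumℕ f) * B
    sum-≤ {zero}  f z≤B = inj₂ (sym (zeroˡ B))
    sum-≤ {suc n} f {z} z≤B = begin
      fromℕ (f Fin.zero) * z Fin.zero + sum (λ j → fromℕ (f (Fin.suc j)) * z (Fin.suc j))
        ≤⟨ +-mono-≤ (fromℕ-*-≤ (ℕ.≤-refl {f Fin.zero}) (z≤B Fin.zero) 0≤B)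
                    (sum-≤ (f ∘ Fin.suc) (z≤B ∘ Fin.suc)) ⟩
      fromℕ (f Fin.zero) * B + fromℕ (sumℕ (f ∘ Fin.suc)) * B
        ≈⟨ sym (distribʳ B _ _) ⟩
      (fromℕ (f Fin.zero) + fromℕ (sumℕ (f ∘ Fin.suc))) * B
        ≈⟨ *-congʳ (sym (fromℕ-+ (f Fin.zero) (sumℕ (f ∘ Fin.suc)))) ⟩
      fromℕ (sumℕ f) * B                   ∎

  argmax : ∀ {n} (g : Fin (suc n) → Carrier) → ∃ λ i → ∀ j → g j ≤ g i
  argmax {zero}  g = Fin.zero , λ { Fin.zero → inj₂ refl }
  argmax {suc n} g with argmax (g ∘ Fin.suc)
  ... | i , max with <-or-≥ (g Fin.zero) (g (Fin.suc i))
  ...   | inj₁ g₀<gᵢ = Fin.suc i , λ { Fin.zero → inj₁ g₀<gᵢ ; (Fin.suc j) → max j }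
  ...   | inj₂ gᵢ≤g₀ = Fin.zero , λ where
            Fin.zero    → inj₂ refl
            (Fin.suc j) → begin g (Fin.suc j) ≤⟨ max j ⟩ g (Fin.suc i) ≤⟨ gᵢ≤g₀ ⟩ g Fin.zero ∎

  EigenEquation : ∀ {n} → (Fin n → Fin n → Carrier) → Carrier → (Fin n → Carrier) → Set ℓ₁
  EigenEquation M μ x = ∀ i → sum (λ j → M i j * x j) ≈ μ * x i

  EigenEquation-fromΣ : ∀ {n} {M : Fin n → Fin n → Carrier} {μ x} →
    (∀ i → Σ[ (λ j → M i j * x j) ] ≈ μ * x i) → EigenEquation M μ x
  EigenEquation-fromΣ {M = M} {x = x} eig i = trans (reflexive (≡.sym (Σ≡sum (λ j → M i j * x j)))) (eig i)

  EigenEquation-neg : ∀ {n} {M : Fin n → Fin n → Carrier} {μ x} →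
    EigenEquation M μ x → EigenEquation M μ (-_ ∘ x)
  EigenEquation-neg {M = M} {μ} {x} eig i = begin-equality
    sum (λ j → M i j * - x j)    ≈⟨ sum-cong-≋ (λ j → sym (-‿distribʳ-* (M i j) (x j))) ⟩
    sum (λ j → - (M i j * x j))  ≈⟨ sum-neg (λ j → M i j * x j) ⟩
    - sum (λ j → M i j * x j)    ≈⟨ -‿cong (eig i) ⟩
    - (μ * x i)                  ≈⟨ -‿distribʳ-* μ (x i) ⟩
    μ * - x i                    ∎

  eigenvector-with-positive-entry : ∀ {n} {M : Fin n → Fin n → Carrier} {μ} → IsEigenvalue M μ →
    Σ (Fin n → Carrier) λ x → (∃ λ j → 0# < x j) × EigenEquation M μ x
  eigenvector-with-positive-entry (x , (j , xⱼ≉0) , eig) with compare (x j) 0#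
  ... | tri< xⱼ<0 _ _ = -_ ∘ x , (j , neg-pos xⱼ<0) , EigenEquation-neg (EigenEquation-fromΣ eig)
  ... | tri≈ _ xⱼ≈0 _ = ⊥-elim (xⱼ≉0 xⱼ≈0)
  ... | tri> _ _ 0<xⱼ = x , (j , 0<xⱼ) , EigenEquation-fromΣ eig

  Qᶠ : ∀ {n} → SimpleGraph n → Fin n → Fin n → Carrier
  Qᶠ G u v = fromℕ (signlessLaplacian G u v)

  signlessLaplacian-row : ∀ {n} (G : SimpleGraph n) {μ x} → EigenEquation (Qᶠ G) μ x → ∀ i →
    μ * x i ≈ fromℕ (degree G i) * x i + sum (λ j → fromℕ (b2n (adj G i j)) * x j)
  signlessLaplacian-row G {μ} {x} eig i = begin-equality
    μ * x i                              ≈⟨ sym (eig i) ⟩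
    sum (λ j → Qᶠ G i j * x j)           ≈⟨ sum-cong-≋ split ⟩
    sum (λ j → diagonal j + adjacency j) ≈⟨ ∑-distrib-+ diagonal adjacency ⟩
    sum diagonal + sum adjacency         ≈⟨ +-congʳ (sum-diagonal i d x) ⟩
    fromℕ d * x i + sum adjacency        ∎
    where
    d = degree G i
    diagonal adjacency : Fin _ → Carrier
    diagonal  j = fromℕ (d ℕ.* b2n ⌊ i Fin.≟ j ⌋) * x j
    adjacency j = fromℕ (b2n (adj G i j)) * x j
    split : ∀ j → Qᶠ G i j * x j ≈ diagonal j + adjacency j
    split j = trans (*-congʳ (fromℕ-+ (d ℕ.* b2n ⌊ i Fin.≟ j ⌋) (b2n (adj G i j)))) (distribʳ (x j) _ _)

  module ApexArgument {n} (G : SimpleGraph (suc n)) {N α D₀ D₁ : ℕ}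
    (α-pos : 1 ℕ.≤ α)
    (apex-row : (α ℕ.+ 1) ℕ.* D₀ ℕ.< α ℕ.* N)
    (other-row : α ℕ.* D₁ ℕ.+ α ℕ.* α ℕ.+ D₁ ℕ.* α ℕ.< α ℕ.* N)
    (degree-≤-D₀ : ∀ v → degree G v ℕ.≤ D₀)
    (degree-≤-D₁ : ∀ v → degree G (Fin.suc v) ℕ.≤ D₁)
    {μ} (N≤μ : fromℕ N ≤ μ) {x} (eig : EigenEquation (Qᶠ G) μ x) {j₀} (0<xⱼ₀ : 0# < x j₀)
    where

    a : Carrier
    a = fromℕ α

    0<a : 0# < a
    0<a = fromℕ-mono-< α-pos

    weight : Fin (suc n) → Carrier
    weight Fin.zero    = 1#
    weight (Fin.suc _) = a

    0<weight : ∀ j → 0# < weight j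
    0<weight Fin.zero    = 0<1
    0<weight (Fin.suc _) = 0<a

    A : Fin (suc n) → Fin (suc n) → ℕ
    A i j = b2n (adj G i j)

    A-irrefl : ∀ i y → fromℕ (A i i) * y ≈ 0#
    A-irrefl i y rewrite adj-irrefl G i = zeroˡ y

    scaled-row : ∀ i → a * μ * x i ≈ a * (fromℕ (degree G i) * x i) + sum (λ j → fromℕ (A i j) * (a * x j))
    scaled-row i = begin-equality
      a * μ * x i                                            ≈⟨ *-assoc a μ (x i) ⟩
      a * (μ * x i)                                          ≈⟨ *-congˡ (signlessLaplacian-row G eig i) ⟩
      a * (d * x i + sum Ax)                                 ≈⟨ distribˡ a _ _ ⟩
      a * (d * x i) + a * sum Ax                             ≈⟨ +-congˡ (*-distribˡ-sum a Ax) ⟩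
      a * (d * x i) + sum (λ j → a * (fromℕ (A i j) * x j))
        ≈⟨ +-congˡ (sum-cong-≋ (λ j → x*[y*z]≈y*[x*z] a (fromℕ (A i j)) (x j))) ⟩
      a * (d * x i) + sum (λ j → fromℕ (A i j) * (a * x j))  ∎
      where
      d = fromℕ (degree G i)
      Ax = λ j → fromℕ (A i j) * x j
      x*[y*z]≈y*[x*z] : ∀ x y z → x * (y * z) ≈ y * (x * z)
      x*[y*z]≈y*[x*z] = solve 3 (λ x y z → x :* (y :* z) := y :* (x :* z)) refl

    below-scaled-μ : ∀ {K y} → K ℕ.< α ℕ.* N → 0# < y → fromℕ K * y < a * μ * y
    below-scaled-μ {K} {y} K<αN 0<y = begin-strict
      fromℕ K * y          <⟨ *-monoʳ-< 0<y (fromℕ-mono-< K<αN) ⟩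
      fromℕ (α ℕ.* N) * y  ≈⟨ *-congʳ (fromℕ-* α N) ⟩
      a * fromℕ N * y      ≤⟨ *-monoʳ-≤ (<⇒≤ 0<y) (*-monoˡ-≤ (<⇒≤ 0<a) N≤μ) ⟩
      a * μ * y            ∎

    0<weighted-max : ∀ {i} → (∀ j → weight j * x j ≤ weight i * x i) → 0# < weight i * x i
    0<weighted-max {i} max = begin-strict
      0#                  <⟨ *-pos (0<weight j₀) 0<xⱼ₀ ⟩
      weight j₀ * x j₀    ≤⟨ max j₀ ⟩
      weight i * x i      ∎

    apex-not-max : (∀ j → weight j * x j ≤ weight Fin.zero * x Fin.zero) → ⊥
    apex-not-max max = <-irrefl refl (begin-strict
      a * μ * x₀
        ≈⟨ scaled-row Fin.zero ⟩
      a * (fromℕ (degree G Fin.zero) * x₀) + (fromℕ (A Fin.zero Fin.zero) * (a * x₀) + others)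
        ≤⟨ +-mono-≤ (*-monoˡ-≤ (<⇒≤ 0<a) (fromℕ-*-≤ (degree-≤-D₀ Fin.zero) (inj₂ refl) (<⇒≤ 0<x₀)))
                    (+-mono-≤ (inj₂ (A-irrefl Fin.zero (a * x₀)))
                              (sum-fromℕ-*-≤ (A Fin.zero ∘ Fin.suc) others-≤ (<⇒≤ 0<x₀) tail-≤)) ⟩
      a * (fromℕ D₀ * x₀) + (0# + fromℕ D₀ * x₀)
        ≈⟨ solve 3 (λ a d y → a :* (d :* y) :+ (con 0 :+ d :* y) := (a :+ con 1) :* d :* y)
                   refl a (fromℕ D₀) x₀ ⟩
      (a + 1#) * fromℕ D₀ * x₀
        ≈⟨ *-congʳ (sym (fromℕ-[α+1]*D₀)) ⟩
      fromℕ ((α ℕ.+ 1) ℕ.* D₀) * x₀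
        <⟨ below-scaled-μ apex-row 0<x₀ ⟩
      a * μ * x₀ ∎)
      where
      x₀ = x Fin.zero
      others = sum (λ j → fromℕ (A Fin.zero (Fin.suc j)) * (a * x (Fin.suc j)))
      0<x₀ : 0# < x₀
      0<x₀ = <-respʳ-≈ (*-identityˡ x₀) (0<weighted-max max)
      others-≤ : ∀ j → a * x (Fin.suc j) ≤ x₀
      others-≤ j = begin
        a * x (Fin.suc j)  ≤⟨ max (Fin.suc j) ⟩
        1# * x₀            ≈⟨ *-identityˡ x₀ ⟩
        x₀                 ∎
      tail-≤ : sumℕ (A Fin.zero ∘ Fin.suc) ℕ.≤ D₀
      tail-≤ = ℕ.≤-trans (ℕ.m≤n+m _ (A Fin.zero Fin.zero)) (degree-≤-D₀ Fin.zero)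
      fromℕ-[α+1]*D₀ : fromℕ ((α ℕ.+ 1) ℕ.* D₀) ≈ (a + 1#) * fromℕ D₀
      fromℕ-[α+1]*D₀ =
        trans (fromℕ-* (α ℕ.+ 1) D₀) (*-congʳ (trans (fromℕ-+ α 1) (+-congˡ (+-identityʳ 1#))))

    other-not-max : ∀ i → (∀ j → weight j * x j ≤ weight (Fin.suc i) * x (Fin.suc i)) → ⊥
    other-not-max i max = <-irrefl refl (begin-strict
      a * μ * y
        ≈⟨ scaled-row v ⟩
      a * (fromℕ (degree G v) * y) + (fromℕ (A v Fin.zero) * (a * x Fin.zero) + others)
        ≤⟨ +-mono-≤ (*-monoˡ-≤ (<⇒≤ 0<a) (fromℕ-*-≤ (degree-≤-D₁ i) (inj₂ refl) (<⇒≤ 0<y)))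
                    (+-mono-≤ (fromℕ-*-≤ (b2n≤1 (adj G v Fin.zero)) apex-≤ (<⇒≤ (*-pos 0<a 0<ay)))
                              (sum-fromℕ-*-≤ (A v ∘ Fin.suc) others-≤ (<⇒≤ 0<ay) tail-≤)) ⟩
      a * (fromℕ D₁ * y) + (fromℕ 1 * (a * (a * y)) + fromℕ D₁ * (a * y))
        ≈⟨ +-congˡ (+-congʳ (trans (*-congʳ (+-identityʳ 1#)) (*-identityˡ _))) ⟩
      a * (fromℕ D₁ * y) + (a * (a * y) + fromℕ D₁ * (a * y))
        ≈⟨ solve 3 (λ a d y → a :* (d :* y) :+ (a :* (a :* y) :+ d :* (a :* y))
                              := (a :* d :+ a :* a :+ d :* a) :* y) refl a (fromℕ D₁) y ⟩
      (a * fromℕ D₁ + a * a + fromℕ D₁ * a) * y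
        ≈⟨ *-congʳ (sym fromℕ-K) ⟩
      fromℕ (α ℕ.* D₁ ℕ.+ α ℕ.* α ℕ.+ D₁ ℕ.* α) * y
        <⟨ below-scaled-μ other-row 0<y ⟩
      a * μ * y ∎)
      where
      v = Fin.suc i
      y = x v
      others = sum (λ j → fromℕ (A v (Fin.suc j)) * (a * x (Fin.suc j)))
      others-≤ : ∀ j → a * x (Fin.suc j) ≤ a * y
      others-≤ j = max (Fin.suc j)
      0<ay : 0# < a * y
      0<ay = 0<weighted-max max
      0<y : 0# < y
      0<y = pos-*-cancelˡ 0<a 0<ay
      apex-≤ : a * x Fin.zero ≤ a * (a * y)
      apex-≤ = *-monoˡ-≤ (<⇒≤ 0<a) (begin
        x Fin.zero       ≈⟨ sym (*-identityˡ (x Fin.zero)) ⟩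
        1# * x Fin.zero  ≤⟨ max Fin.zero ⟩
        a * y            ∎)
      tail-≤ : sumℕ (A v ∘ Fin.suc) ℕ.≤ D₁
      tail-≤ = ℕ.≤-trans (ℕ.m≤n+m _ (A v Fin.zero)) (degree-≤-D₁ i)
      fromℕ-K : fromℕ (α ℕ.* D₁ ℕ.+ α ℕ.* α ℕ.+ D₁ ℕ.* α) ≈ a * fromℕ D₁ + a * a + fromℕ D₁ * a
      fromℕ-K = trans (fromℕ-+ (α ℕ.* D₁ ℕ.+ α ℕ.* α) (D₁ ℕ.* α))
        (+-cong (trans (fromℕ-+ (α ℕ.* D₁) (α ℕ.* α)) (+-cong (fromℕ-* α D₁) (fromℕ-* α α)))
                (fromℕ-* D₁ α))

    impossible : ⊥
    impossible with argmax (λ j → weight j * x j)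
    ... | Fin.zero  , max = apex-not-max max
    ... | Fin.suc i , max = other-not-max i max

  signlessLaplacian-eigenvalue-< : ∀ {n} (G : SimpleGraph n) (N : ℕ) {α D₀ D₁ : ℕ} →
    1 ℕ.≤ α →
    (α ℕ.+ 1) ℕ.* D₀ ℕ.< α ℕ.* N →
    α ℕ.* D₁ ℕ.+ α ℕ.* α ℕ.+ D₁ ℕ.* α ℕ.< α ℕ.* N →
    (∀ v → degree G v ℕ.≤ D₀) →
    (∀ v m → toℕ v ≡ suc m → degree G v ℕ.≤ D₁) →
    ∀ {μ} → IsEigenvalue (Qᶠ G) μ → μ < fromℕ N
  signlessLaplacian-eigenvalue-< {zero} G N _ _ _ _ _ (_ , (() , _) , _)
  signlessLaplacian-eigenvalue-< {suc n} G N α-pos apex-row other-row degree-≤-D₀ degree-≤-D₁ {μ} ev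
    with <-or-≥ μ (fromℕ N) | eigenvector-with-positive-entry {M = Qᶠ G} ev
  ... | inj₁ μ<N | _                          = μ<N
  ... | inj₂ N≤μ | x , (j₀ , 0<xⱼ₀) , eig = ⊥-elim (ApexArgument.impossible G α-pos apex-row other-row
      degree-≤-D₀ (λ v → degree-≤-D₁ (Fin.suc v) (toℕ v) ≡.refl) N≤μ eig 0<xⱼ₀)


open import Data.Nat using (ℕ; _≤_; _+_; _*_; _∸_)
open import Data.Product using (_,_)

corollary2 : ∀ {c ℓ₁ ℓ₂ : Level} (F : OrderedField c ℓ₁ ℓ₂) (k p : ℕ) →
    2 ≤ k →
    6 * k + 13 ≤ order k p →
    ∀ (μ : OrderedField.Carrier F) →
      OrderedField.IsEigenvalue F
        (λ u v → OrderedField.fromℕ F (signlessLaplacian (joinGraph k p) u v)) μ →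
      OrderedField._<_ F μ (OrderedField.fromℕ F (order k p + 2 * k ∸ 2))
corollary2 F k p 2≤k 6k+13≤n μ ev with ApexWeight.apex-weight (order k p) k 2≤k 6k+13≤n
... | α , α-pos , apex-row , other-row =
  EigenvalueBound.signlessLaplacian-eigenvalue-< F (joinGraph k p) (order k p + 2 * k ∸ 2)
    α-pos apex-row other-row
    (DegreeBounds.degree-≤-pred (joinGraph k p)) (DegreeBounds.joinGraph-degree-≤ k p) ev
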